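{- Let $n,m\in\mathbb{N}$ and let $(\boldsymbol{d},\boldsymbol{k})$, with $\boldsymbol{d}=(d_1,\ldots,d_n)$ and $\boldsymbol{k}=(k_1,\ldots,k_m)$ sequences of nonnegative integers, be a bipartite degree sequence for the bipartition $X=\{x_1,\ldots,x_n\}$, $Y=\{y_1,\ldots,y_m\}$. Suppose $g,h\in[n]$ satisfy $d_g\geq d_h+2$, and define $\boldsymbol{d}'$ by $d'_g=d_g-1$, $d'_h=d_h+1$ and $d'_i=d_i$ for $i\in[n]\setminus\{g,h\}$. Then \[|\mathcal{B}(\boldsymbol{d},\boldsymbol{k})|\leq|\mathcal{B}(\boldsymbol{d}',\boldsymbol{k})|.\]
   Context: $\mathcal{B}(\boldsymbol{d},\boldsymbol{k})$ denotes the set of all simple bipartite graphs with parts $X$ and $Y$ (edges only between $X$ and $Y$) such that $\deg(x_i)=d_i$ for all $i\in[n]$ and $\deg(y_j)=k_j$ for all $j\in[m]$. -}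

module Defs where

open import Data.Bool using (Bool; true; false; if_then_else_)
open import Data.Nat using (ℕ; zero; suc; _+_; _∸_; _≟_)
open import Data.Fin using (Fin; zero; suc)
open import Data.Fin.Properties using (all?)
open import Data.Nat.ListAction using (sum)
open import Data.List using (List; []; _∷_; map; length; allFin; filter; concatMap)
open import Data.Product using (_×_)
open import Relation.Binary.PropositionalEquality using (_≡_)
open import Relation.Nullary using (Dec; yes; no)
open import Relation.Nullary.Decidable using (_×-dec_)

-- A simple bipartite graph with parts X = {x_0..x_(n-1)}, Y = {y_0..y_(m-1)}
-- (edges only between X and Y) is given by its biadjacency relation:
-- G i j = true iff x_i y_j is an edge.
BGraph : ℕ → ℕ → Set
BGraph n m = Fin n → Fin m → Bool

ind : Bool → ℕ
ind true  = 1
ind false = 0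

degX : ∀ {n m} → BGraph n m → Fin n → ℕ
degX {m = m} G i = sum (map (λ j → ind (G i j)) (allFin m))

degY : ∀ {n m} → BGraph n m → Fin m → ℕ
degY {n = n} G j = sum (map (λ i → ind (G i j)) (allFin n))

InB : ∀ {n m} → (Fin n → ℕ) → (Fin m → ℕ) → BGraph n m → Set
InB d k G = (∀ i → degX G i ≡ d i) × (∀ j → degY G j ≡ k j)

InB? : ∀ {n m} (d : Fin n → ℕ) (k : Fin m → ℕ) (G : BGraph n m) → Dec (InB d k G)
InB? d k G = all? (λ i → degX G i ≟ d i) ×-dec all? (λ j → degY G j ≟ k j)

allFuns : ∀ {A : Set} → List A → (n : ℕ) → List (Fin n → A)
allFuns xs zero    = (λ ()) ∷ []
allFuns xs (suc n) =
  concatMap (λ a → map (λ f → λ { zero → a ; (suc i) → f i }) (allFuns xs n)) xs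

-- every bipartite graph on X,Y, each exactly once
allBGraphs : (n m : ℕ) → List (BGraph n m)
allBGraphs n m = allFuns (allFuns (true ∷ false ∷ []) m) n

cardB : ∀ {n m} → (Fin n → ℕ) → (Fin m → ℕ) → ℕ
cardB {n} {m} d k = length (filter (InB? d k) (allBGraphs n m))

IsBipartiteDegSeq : ∀ {n m} → (Fin n → ℕ) → (Fin m → ℕ) → Set
IsBipartiteDegSeq {n} {m} d k = Data.Product.∃ (λ (G : BGraph n m) → InB d k G)

-- d' : d'_g = d_g - 1, d'_h = d_h + 1, d'_i = d_i otherwise (needs g ≢ h)
shift : ∀ {n} → (Fin n → ℕ) → Fin n → Fin n → Fin n → ℕ
shift d g h i with Data.Fin._≟_ i g | Data.Fin._≟_ i h
... | yes _ | _     = d i ∸ 1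
... | no _  | yes _ = suc (d i)
... | no _  | no _  = d i

module Submission where

-- We construct an injection  moveEdge : B(d,k) → B(d',k).  Only the rows g
-- and h of the biadjacency matrix change, and they are handled as a vector
-- of columns (G g j , G h j).  Reading the columns from right to left, every
-- column (1,0) cancels one pending column (0,1) to its right; a (1,0) column
-- finding nothing to cancel is "free".  Since row g has more ones than row h,
-- a free column exists ('balance'), and 'transfer' turns the leftmost free
-- column into (0,1).  This keeps every column sum (hence the Y-degrees),
-- moves one unit of degree from x_g to x_h, and is undone by 'untransfer',
-- so moveEdge is injective on B(d,k).

open import Defs
open import Level using (Level; 0ℓ)
open import Data.Bool using (Bool; true; false)
open import Data.Bool.Properties using () renaming (≡-setoid to Bool-setoid)
open import Data.Nat using (ℕ; zero; suc; pred; _+_; _∸_; _≤_; _<_; z≤n; s≤s)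
open import Data.Nat.Properties
  using (+-comm; +-assoc; +-suc; +-identityʳ; +-commutativeSemigroup;
         <-irrefl; m≤m+n; m<m+n; <-≤-trans; module ≤-Reasoning)
open import Algebra.Properties.CommutativeSemigroup +-commutativeSemigroup using (xy∙z≈xz∙y)
open import Data.Nat.ListAction using (sum)
open import Data.Fin using (Fin; zero; suc; _≟_)
open import Data.Fin.Properties using (suc-injective)
open import Data.List using (List; []; _∷_; length; map; tabulate)
open import Data.List.Properties using (length-removeAt′; tabulate-cong; map-tabulate)
open import Data.List.Relation.Unary.All as All using (All; []; _∷_)
import Data.List.Relation.Unary.All.Properties as All
open import Data.List.Relation.Unary.Any as Any using (here; there; index)
import Data.List.Relation.Unary.Any.Properties as Any
open import Data.List.Relation.Unary.AllPairs as AllPairs using ([]; _∷_)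
import Data.List.Relation.Unary.AllPairs.Properties as AllPairs
import Data.List.Relation.Unary.Unique.Setoid as UniqueSetoid
import Data.List.Relation.Unary.Unique.Setoid.Properties as Unique
import Data.List.Membership.Setoid as Membership
open import Data.List.Membership.Setoid.Properties using (∈-filter⁺)
import Data.Vec.Functional.Relation.Binary.Pointwise.Properties as Pointwise
open import Data.Vec using (Vec; []; _∷_; lookup)
import Data.Vec as Vec
open import Data.Vec.Properties using (lookup∘tabulate; tabulate∘lookup)
  renaming (tabulate-cong to tabulateᵥ-cong)
open import Data.Product using (_×_; _,_; proj₁; proj₂; ∃)
open import Data.Empty using (⊥-elim)
open import Relation.Nullary using (yes; no)
open import Relation.Unary using (Pred)
open import Relation.Binary.Bundles using (Setoid)
open import Relation.Binary.PropositionalEquality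
open import Function using (id)

private
  variable
    a b ℓ₁ ℓ₂ p : Level

module Pigeonhole (S : Setoid a ℓ₁) (T : Setoid b ℓ₂) where

  open Setoid S using () renaming (Carrier to A; _≈_ to _≈₁_; _≉_ to _≉₁_)
  open Setoid T using (_≉_) renaming (Carrier to B; _≈_ to _≈₂_; trans to trans₂; sym to sym₂)
  open UniqueSetoid S using (Unique)
  open Membership T using (_∈_; _─_)

  ∈-─ : ∀ {v w} {ys : List B} (p : v ∈ ys) → w ∈ ys → w ≉ v → w ∈ ys ─ p
  ∈-─ (here v≈y) (here w≈y) w≉v = ⊥-elim (w≉v (trans₂ w≈y (sym₂ v≈y)))
  ∈-─ (here _)   (there q)  _   = q
  ∈-─ (there p)  (here w≈y) _   = here w≈y
  ∈-─ (there p)  (there q)  w≉v = there (∈-─ p q w≉v)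

  -- Induction on xs: the image of the head occupies one position of ys,
  -- and the tail maps into ys with that position removed.
  injection-length : ∀ {P : Pred A p} {f : A → B} {xs : List A} {ys : List B} →
    Unique xs → All P xs → (∀ {x y} → P x → P y → f x ≈₂ f y → x ≈₁ y) →
    All (λ x → f x ∈ ys) xs → length xs ≤ length ys
  injection-length [] [] inj [] = z≤n
  injection-length {f = f} {x ∷ xs} {ys} (x≉xs ∷ xs!) (px ∷ pxs) inj (fx∈ys ∷ fxs∈ys) = begin
    suc (length xs)            ≤⟨ s≤s (injection-length xs! pxs inj rest∈) ⟩
    suc (length (ys ─ fx∈ys))  ≡⟨ length-removeAt′ ys (index fx∈ys) ⟨
    length ys                  ∎
    where
    open ≤-Reasoning
    rest∈ : All (λ z → f z ∈ ys ─ fx∈ys) xs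
    rest∈ = All.zipWith
      (λ { (x≉z , (pz , fz∈ys)) → ∈-─ fx∈ys fz∈ys (λ fz≈fx → x≉z (inj px pz (sym₂ fz≈fx))) })
      (x≉xs , All.zip (pxs , fxs∈ys))

module FunctionSpace (S : Setoid 0ℓ ℓ₁) where

  open Setoid S using (Carrier; _≈_) renaming (sym to ≈-sym; trans to ≈-trans)
  open Membership S using (_∈_)
  open UniqueSetoid S using (Unique)

  pointwise : ℕ → Setoid 0ℓ ℓ₁
  pointwise = Pointwise.setoid S

  allFuns-complete : ∀ {xs} n (f : Fin n → Carrier) → (∀ i → f i ∈ xs) →
    Membership._∈_ (pointwise n) f (allFuns xs n)
  allFuns-complete zero    f f∈xs = here (λ ())
  allFuns-complete (suc n) f f∈xs =
    Any.concat⁺ (Any.map⁺ (Any.map (λ f₀≈a → Any.map⁺ (Any.map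
      (λ tail≈g → λ { zero → f₀≈a ; (suc i) → tail≈g i })
      (allFuns-complete n (λ i → f (suc i)) (λ i → f∈xs (suc i)))))
      (f∈xs zero)))

  -- allFuns xs (suc n) is the concatenation, over a ∈ xs, of the blocks of
  -- functions with value a at zero: each block is duplicate-free, and blocks
  -- of different a are disjoint.
  allFuns-unique : ∀ {xs} → Unique xs → ∀ n → UniqueSetoid.Unique (pointwise n) (allFuns xs n)
  allFuns-unique xs! zero    = [] ∷ []
  allFuns-unique {xs} xs! (suc n) =
    Unique.concat⁺ (pointwise (suc n))
      (All.map⁺ (All.universal (λ _ → Unique.map⁺ (pointwise n) (pointwise (suc n))
        (λ e i → e (suc i)) (allFuns-unique xs! n)) xs))
      (AllPairs.map⁺ (AllPairs.map
        (λ a≉b {_} (v∈a , v∈b) →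
          a≉b (≈-trans (≈-sym (proj₂ (first-entry v∈a))) (proj₂ (first-entry v∈b)))) xs!))
    where
    first-entry : ∀ {v} {c : (Fin n → Carrier) → Fin (suc n) → Carrier} {L} →
      Membership._∈_ (pointwise (suc n)) v (map c L) → ∃ λ g → v zero ≈ c g zero
    first-entry v∈ with Any.satisfied (Any.map⁻ v∈)
    ... | g , v≈cg = g , v≈cg zero

count : ∀ {m} → (Fin m → Bool) → ℕ
count r = sum (tabulate (λ j → ind (r j)))

count-cong : ∀ {m} {r r′ : Fin m → Bool} → (∀ j → r j ≡ r′ j) → count r ≡ count r′
count-cong e = cong sum (tabulate-cong (λ j → cong ind (e j)))

sum-exchange : ∀ {n} (f f′ : Fin n → ℕ) (x : Fin n) {a a′ : ℕ} →
  (∀ i → i ≢ x → f′ i ≡ f i) → f′ x + a′ ≡ f x + a →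
  sum (tabulate f′) + a′ ≡ sum (tabulate f) + a
sum-exchange f f′ zero {a} {a′} same e = begin
  (f′ zero + S′) + a′  ≡⟨ cong (λ t → (f′ zero + t) + a′) S′≡S ⟩
  (f′ zero + S) + a′   ≡⟨ xy∙z≈xz∙y (f′ zero) S a′ ⟩
  (f′ zero + a′) + S   ≡⟨ cong (_+ S) e ⟩
  (f zero + a) + S     ≡⟨ xy∙z≈xz∙y (f zero) S a ⟨
  (f zero + S) + a     ∎
  where
  open ≡-Reasoning
  S = sum (tabulate (λ i → f (suc i)))
  S′ = sum (tabulate (λ i → f′ (suc i)))
  S′≡S : S′ ≡ S
  S′≡S = cong sum (tabulate-cong (λ i → same (suc i) λ ()))
sum-exchange f f′ (suc x) {a} {a′} same e = begin
  (f′ zero + S′) + a′  ≡⟨ +-assoc (f′ zero) S′ a′ ⟩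
  f′ zero + (S′ + a′)  ≡⟨ cong₂ _+_ (same zero λ ()) tail-exchange ⟩
  f zero + (S + a)     ≡⟨ +-assoc (f zero) S a ⟨
  (f zero + S) + a     ∎
  where
  open ≡-Reasoning
  S = sum (tabulate (λ i → f (suc i)))
  S′ = sum (tabulate (λ i → f′ (suc i)))
  tail-exchange : S′ + a′ ≡ S + a
  tail-exchange = sum-exchange (λ i → f (suc i)) (λ i → f′ (suc i)) x
    (λ i i≢x → same (suc i) (λ eq → i≢x (suc-injective eq))) e

sum-exchange-head : ∀ {n} (f f′ : Fin (suc n) → ℕ) (x : Fin n) →
  (∀ i → i ≢ x → f′ (suc i) ≡ f (suc i)) → f′ (suc x) + f′ zero ≡ f (suc x) + f zero →
  sum (tabulate f′) ≡ sum (tabulate f)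
sum-exchange-head f f′ x same e = begin
  f′ zero + S′  ≡⟨ +-comm (f′ zero) S′ ⟩
  S′ + f′ zero  ≡⟨ sum-exchange (λ i → f (suc i)) (λ i → f′ (suc i)) x same e ⟩
  S + f zero    ≡⟨ +-comm S (f zero) ⟩
  f zero + S    ∎
  where
  open ≡-Reasoning
  S = sum (tabulate (λ i → f (suc i)))
  S′ = sum (tabulate (λ i → f′ (suc i)))

sum-exchange-pair : ∀ {n} (f f′ : Fin n → ℕ) {g h : Fin n} → g ≢ h →
  (∀ i → i ≢ g → i ≢ h → f′ i ≡ f i) → f′ g + f′ h ≡ f g + f h →
  sum (tabulate f′) ≡ sum (tabulate f)
sum-exchange-pair f f′ {zero} {zero} g≢h same e = ⊥-elim (g≢h refl)
sum-exchange-pair f f′ {zero} {suc h} g≢h same e =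
  sum-exchange-head f f′ h (λ i i≢h → same (suc i) (λ ()) (λ eq → i≢h (suc-injective eq)))
    (trans (+-comm (f′ (suc h)) (f′ zero)) (trans e (+-comm (f zero) (f (suc h)))))
sum-exchange-pair f f′ {suc g} {zero} g≢h same e =
  sum-exchange-head f f′ g (λ i i≢g → same (suc i) (λ eq → i≢g (suc-injective eq)) (λ ())) e
sum-exchange-pair f f′ {suc g} {suc h} g≢h same e =
  cong₂ _+_ (same zero (λ ()) (λ ()))
    (sum-exchange-pair (λ i → f (suc i)) (λ i → f′ (suc i)) (λ eq → g≢h (cong suc eq))
      (λ i i≢g i≢h → same (suc i) (λ eq → i≢g (suc-injective eq)) (λ eq → i≢h (suc-injective eq)))
      e)

degX≡count : ∀ {n m} (G : BGraph n m) (i : Fin n) → degX G i ≡ count (G i)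
degX≡count G i = cong sum (map-tabulate id (λ j → ind (G i j)))

degY≡count : ∀ {n m} (G : BGraph n m) (j : Fin m) → degY G j ≡ count (λ i → G i j)
degY≡count G j = cong sum (map-tabulate id (λ i → ind (G i j)))

-- The rows g and h of a graph are handled as a vector of columns
-- (G g j , G h j).  A column (true , false) is "g-only", (false , true) is
-- "h-only".
Column : Set
Column = Bool × Bool

gRow hRow : ∀ {m} → Vec Column m → Fin m → Bool
gRow cs j = proj₁ (lookup cs j)
hRow cs j = proj₂ (lookup cs j)

weight : Column → ℕ
weight (a , b) = ind a + ind b

-- Reading the columns from right to left, each g-only column cancels one
-- pending h-only column to its right; 'pending' counts those left uncancelled.
pending : ∀ {m} → Vec Column m → ℕ
pending [] = 0
pending ((true  , false) ∷ cs) = pred (pending cs)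
pending ((false , true)  ∷ cs) = suc (pending cs)
pending ((true  , true)  ∷ cs) = pending cs
pending ((false , false) ∷ cs) = pending cs

-- g-only columns that find nothing to cancel.
free : ∀ {m} → Vec Column m → ℕ
free [] = 0
free ((true , false) ∷ cs) with pending cs
... | zero  = suc (free cs)
... | suc _ = free cs
free (_ ∷ cs) = free cs

transfer : ∀ {m} → Vec Column m → Vec Column m
transfer [] = []
transfer ((true , false) ∷ cs) with pending cs
... | zero  = (false , true) ∷ cs
... | suc _ = (true , false) ∷ transfer cs
transfer (c ∷ cs) = c ∷ transfer cs

untransfer : ∀ {m} → Vec Column m → Vec Column m
untransfer [] = []
untransfer ((false , true) ∷ cs) with pending cs
... | zero  = (true , false) ∷ cs
... | suc _ = (false , true) ∷ untransfer cs
untransfer (c ∷ cs) = c ∷ untransfer cs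

-- Every g-only column is either free or cancels a pending h-only column.
balance : ∀ {m} (cs : Vec Column m) →
  count (gRow cs) + pending cs ≡ count (hRow cs) + free cs
balance [] = refl
balance ((true , false) ∷ cs) with pending cs | balance cs
... | zero  | e = trans (cong suc e) (sym (+-suc _ _))
... | suc p | e = trans (sym (+-suc _ p)) e
balance ((false , true) ∷ cs) = trans (+-suc _ _) (cong suc (balance cs))
balance ((true , true) ∷ cs) = cong suc (balance cs)
balance ((false , false) ∷ cs) = balance cs

free-positive : ∀ {m} (cs : Vec Column m) → count (hRow cs) < count (gRow cs) → 0 < free cs
free-positive cs lt with free cs in eq
... | suc _ = s≤s z≤n
... | zero = ⊥-elim (<-irrefl refl (begin-strict
  count (hRow cs)               <⟨ lt ⟩
  count (gRow cs)               ≤⟨ m≤m+n _ _ ⟩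
  count (gRow cs) + pending cs  ≡⟨ balance cs ⟩
  count (hRow cs) + free cs     ≡⟨ cong (count (hRow cs) +_) eq ⟩
  count (hRow cs) + 0           ≡⟨ +-identityʳ _ ⟩
  count (hRow cs)               ∎))
  where open ≤-Reasoning

transfer-weight : ∀ {m} (cs : Vec Column m) (j : Fin m) →
  weight (lookup (transfer cs) j) ≡ weight (lookup cs j)
transfer-weight ((true , false) ∷ cs) j with pending cs
transfer-weight ((true , false) ∷ cs) zero    | zero  = refl
transfer-weight ((true , false) ∷ cs) (suc j) | zero  = refl
transfer-weight ((true , false) ∷ cs) zero    | suc _ = refl
transfer-weight ((true , false) ∷ cs) (suc j) | suc _ = transfer-weight cs j
transfer-weight ((false , true)  ∷ cs) zero    = refl
transfer-weight ((false , true)  ∷ cs) (suc j) = transfer-weight cs j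
transfer-weight ((true , true)   ∷ cs) zero    = refl
transfer-weight ((true , true)   ∷ cs) (suc j) = transfer-weight cs j
transfer-weight ((false , false) ∷ cs) zero    = refl
transfer-weight ((false , false) ∷ cs) (suc j) = transfer-weight cs j

transfer-counts : ∀ {m} (cs : Vec Column m) → 0 < free cs →
  suc (count (gRow (transfer cs))) ≡ count (gRow cs) ×
  count (hRow (transfer cs)) ≡ suc (count (hRow cs))
transfer-counts ((true , false) ∷ cs) pos with pending cs
... | zero  = refl , refl
... | suc _ = let (eg , eh) = transfer-counts cs pos in cong suc eg , eh
transfer-counts ((false , true) ∷ cs) pos =
  let (eg , eh) = transfer-counts cs pos in eg , cong suc eh
transfer-counts ((true , true) ∷ cs) pos =
  let (eg , eh) = transfer-counts cs pos in cong suc eg , cong suc eh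
transfer-counts ((false , false) ∷ cs) pos = transfer-counts cs pos

-- The new h-only column becomes pending for everything to its left.
pending-transfer : ∀ {m} (cs : Vec Column m) → 0 < free cs →
  pending (transfer cs) ≡ suc (pending cs)
pending-transfer ((true , false) ∷ cs) pos with pending cs in eq
... | zero  = cong suc eq
... | suc p = trans (cong pred (pending-transfer cs pos)) eq
pending-transfer ((false , true) ∷ cs) pos = cong suc (pending-transfer cs pos)
pending-transfer ((true , true) ∷ cs) pos = pending-transfer cs pos
pending-transfer ((false , false) ∷ cs) pos = pending-transfer cs pos

-- Hence 'untransfer' finds exactly the column changed by 'transfer'.
untransfer-transfer : ∀ {m} (cs : Vec Column m) → 0 < free cs →
  untransfer (transfer cs) ≡ cs
untransfer-transfer ((true , false) ∷ cs) pos with pending cs in eq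
... | zero  rewrite eq = refl
... | suc p = cong ((true , false) ∷_) (untransfer-transfer cs pos)
untransfer-transfer ((false , true) ∷ cs) pos
  rewrite pending-transfer cs pos = cong ((false , true) ∷_) (untransfer-transfer cs pos)
untransfer-transfer ((true , true) ∷ cs) pos = cong ((true , true) ∷_) (untransfer-transfer cs pos)
untransfer-transfer ((false , false) ∷ cs) pos = cong ((false , false) ∷_) (untransfer-transfer cs pos)

module TwoRows {n m : ℕ} {g h : Fin n} (g≢h : g ≢ h) where

  columns : BGraph n m → Vec Column m
  columns G = Vec.tabulate (λ j → G g j , G h j)

  gRow-columns : ∀ G j → gRow (columns G) j ≡ G g j
  gRow-columns G j = cong proj₁ (lookup∘tabulate _ j)

  hRow-columns : ∀ G j → hRow (columns G) j ≡ G h j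
  hRow-columns G j = cong proj₂ (lookup∘tabulate _ j)

  -- Three-way case split on a row index, without unfolding '_≟_' in goals.
  data RowKind (i : Fin n) : Set where
    is-g  : i ≡ g → RowKind i
    is-h  : i ≡ h → RowKind i
    other : i ≢ g → i ≢ h → RowKind i

  classify : ∀ i → RowKind i
  classify i with i ≟ g | i ≟ h
  ... | yes i≡g | _       = is-g i≡g
  ... | no _    | yes i≡h = is-h i≡h
  ... | no i≢g  | no i≢h  = other i≢g i≢h

  setRows : Vec Column m → BGraph n m → BGraph n m
  setRows cs G i j with i ≟ g | i ≟ h
  ... | yes _ | _     = gRow cs j
  ... | no _  | yes _ = hRow cs j
  ... | no _  | no _  = G i j

  setRows-g : ∀ cs G j → setRows cs G g j ≡ gRow cs j
  setRows-g cs G j with g ≟ g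
  ... | yes _ = refl
  ... | no g≢g = ⊥-elim (g≢g refl)

  setRows-h : ∀ cs G j → setRows cs G h j ≡ hRow cs j
  setRows-h cs G j with h ≟ g | h ≟ h
  ... | yes h≡g | _     = ⊥-elim (g≢h (sym h≡g))
  ... | no _    | yes _ = refl
  ... | no _    | no h≢h = ⊥-elim (h≢h refl)

  setRows-other : ∀ cs G i j → i ≢ g → i ≢ h → setRows cs G i j ≡ G i j
  setRows-other cs G i j i≢g i≢h with i ≟ g | i ≟ h
  ... | yes i≡g | _     = ⊥-elim (i≢g i≡g)
  ... | no _    | yes i≡h = ⊥-elim (i≢h i≡h)
  ... | no _    | no _  = refl

  columns-setRows : ∀ cs G → columns (setRows cs G) ≡ cs
  columns-setRows cs G =
    trans (tabulateᵥ-cong (λ j → cong₂ _,_ (setRows-g cs G j) (setRows-h cs G j)))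
          (tabulate∘lookup cs)

  rows-determine : ∀ G G′ → columns G ≡ columns G′ →
    (∀ i j → i ≢ g → i ≢ h → G i j ≡ G′ i j) → ∀ i j → G i j ≡ G′ i j
  rows-determine G G′ same-cols same-rest i j with classify i
  ... | is-g refl =
    trans (sym (gRow-columns G j)) (trans (cong (λ cs → gRow cs j) same-cols) (gRow-columns G′ j))
  ... | is-h refl =
    trans (sym (hRow-columns G j)) (trans (cong (λ cs → hRow cs j) same-cols) (hRow-columns G′ j))
  ... | other i≢g i≢h = same-rest i j i≢g i≢h

  degX-setRows-g : ∀ cs G → degX (setRows cs G) g ≡ count (gRow cs)
  degX-setRows-g cs G = trans (degX≡count (setRows cs G) g) (count-cong (setRows-g cs G))

  degX-setRows-h : ∀ cs G → degX (setRows cs G) h ≡ count (hRow cs)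
  degX-setRows-h cs G = trans (degX≡count (setRows cs G) h) (count-cong (setRows-h cs G))

  degX-setRows-other : ∀ cs G i → i ≢ g → i ≢ h → degX (setRows cs G) i ≡ degX G i
  degX-setRows-other cs G i i≢g i≢h =
    trans (degX≡count (setRows cs G) i)
      (trans (count-cong (λ j → setRows-other cs G i j i≢g i≢h)) (sym (degX≡count G i)))

  degY-setRows : ∀ cs G → (∀ j → weight (lookup cs j) ≡ weight (lookup (columns G) j)) →
    ∀ j → degY (setRows cs G) j ≡ degY G j
  degY-setRows cs G same-weight j = begin
    degY (setRows cs G) j                 ≡⟨ degY≡count (setRows cs G) j ⟩
    count (λ i → setRows cs G i j)        ≡⟨ sum-exchange-pair (λ i → ind (G i j))
                                               (λ i → ind (setRows cs G i j)) g≢h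
                                               (λ i i≢g i≢h → cong ind (setRows-other cs G i j i≢g i≢h))
                                               column-total ⟩
    count (λ i → G i j)                   ≡⟨ degY≡count G j ⟨
    degY G j                              ∎
    where
    open ≡-Reasoning
    column-total : ind (setRows cs G g j) + ind (setRows cs G h j) ≡ ind (G g j) + ind (G h j)
    column-total = begin
      ind (setRows cs G g j) + ind (setRows cs G h j)
        ≡⟨ cong₂ _+_ (cong ind (setRows-g cs G j)) (cong ind (setRows-h cs G j)) ⟩
      weight (lookup cs j)               ≡⟨ same-weight j ⟩
      weight (lookup (columns G) j)
        ≡⟨ cong₂ _+_ (cong ind (gRow-columns G j)) (cong ind (hRow-columns G j)) ⟩
      ind (G g j) + ind (G h j)          ∎

  shift-g : ∀ (d : Fin n → ℕ) → shift d g h g ≡ d g ∸ 1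
  shift-g d with g ≟ g
  ... | yes _ = refl
  ... | no g≢g = ⊥-elim (g≢g refl)

  shift-h : ∀ (d : Fin n → ℕ) → shift d g h h ≡ suc (d h)
  shift-h d with h ≟ g | h ≟ h
  ... | yes h≡g | _      = ⊥-elim (g≢h (sym h≡g))
  ... | no _    | yes _  = refl
  ... | no _    | no h≢h = ⊥-elim (h≢h refl)

  shift-other : ∀ (d : Fin n → ℕ) i → i ≢ g → i ≢ h → shift d g h i ≡ d i
  shift-other d i i≢g i≢h with i ≟ g | i ≟ h
  ... | yes i≡g | _       = ⊥-elim (i≢g i≡g)
  ... | no _    | yes i≡h = ⊥-elim (i≢h i≡h)
  ... | no _    | no _    = refl

  moveEdge : BGraph n m → BGraph n m
  moveEdge G = setRows (transfer (columns G)) G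

  module _ {d : Fin n → ℕ} {k : Fin m → ℕ} (h<g : d h < d g) where

    free-columns : ∀ G → InB d k G → 0 < free (columns G)
    free-columns G (degX≡d , _) = free-positive (columns G) (begin-strict
      count (hRow (columns G)) ≡⟨ count-cong (hRow-columns G) ⟩
      count (G h)              ≡⟨ trans (sym (degX≡count G h)) (degX≡d h) ⟩
      d h                      <⟨ h<g ⟩
      d g                      ≡⟨ trans (sym (degX≡d g)) (degX≡count G g) ⟩
      count (G g)              ≡⟨ count-cong (gRow-columns G) ⟨
      count (gRow (columns G)) ∎)
      where open ≤-Reasoning

    moveEdge-InB : ∀ G → InB d k G → InB (shift d g h) k (moveEdge G)
    moveEdge-InB G inB@(degX≡d , degY≡k) = new-degX , new-degY
      where
      cs = columns G
      counts = transfer-counts cs (free-columns G inB)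
      new-degX : ∀ i → degX (moveEdge G) i ≡ shift d g h i
      new-degX i with classify i
      ... | is-g refl = begin
        degX (moveEdge G) g              ≡⟨ degX-setRows-g (transfer cs) G ⟩
        count (gRow (transfer cs))       ≡⟨ cong (_∸ 1) (proj₁ counts) ⟩
        count (gRow cs) ∸ 1              ≡⟨ cong (_∸ 1) (count-cong (gRow-columns G)) ⟩
        count (G g) ∸ 1                  ≡⟨ cong (_∸ 1) (trans (sym (degX≡count G g)) (degX≡d g)) ⟩
        d g ∸ 1                          ≡⟨ shift-g d ⟨
        shift d g h g                    ∎
        where open ≡-Reasoning
      ... | is-h refl = begin
        degX (moveEdge G) h              ≡⟨ degX-setRows-h (transfer cs) G ⟩
        count (hRow (transfer cs))       ≡⟨ proj₂ counts ⟩
        suc (count (hRow cs))            ≡⟨ cong suc (count-cong (hRow-columns G)) ⟩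
        suc (count (G h))                ≡⟨ cong suc (trans (sym (degX≡count G h)) (degX≡d h)) ⟩
        suc (d h)                        ≡⟨ shift-h d ⟨
        shift d g h h                    ∎
        where open ≡-Reasoning
      ... | other i≢g i≢h =
        trans (degX-setRows-other (transfer cs) G i i≢g i≢h)
              (trans (degX≡d i) (sym (shift-other d i i≢g i≢h)))
      new-degY : ∀ j → degY (moveEdge G) j ≡ k j
      new-degY j = trans (degY-setRows (transfer cs) G (transfer-weight cs) j) (degY≡k j)

    moveEdge-injective : ∀ G₁ G₂ → InB d k G₁ → InB d k G₂ →
      (∀ i j → moveEdge G₁ i j ≡ moveEdge G₂ i j) → ∀ i j → G₁ i j ≡ G₂ i j
    moveEdge-injective G₁ G₂ inB₁ inB₂ same = rows-determine G₁ G₂ same-columns same-rest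
      where
      open ≡-Reasoning
      same-columns : columns G₁ ≡ columns G₂
      same-columns = begin
        columns G₁                          ≡⟨ untransfer-transfer (columns G₁) (free-columns G₁ inB₁) ⟨
        untransfer (transfer (columns G₁))  ≡⟨ cong untransfer (sym (columns-setRows _ G₁)) ⟩
        untransfer (columns (moveEdge G₁))  ≡⟨ cong untransfer (tabulateᵥ-cong (λ j → cong₂ _,_ (same g j) (same h j))) ⟩
        untransfer (columns (moveEdge G₂))  ≡⟨ cong untransfer (columns-setRows _ G₂) ⟩
        untransfer (transfer (columns G₂))  ≡⟨ untransfer-transfer (columns G₂) (free-columns G₂ inB₂) ⟩
        columns G₂                          ∎
      same-rest : ∀ i j → i ≢ g → i ≢ h → G₁ i j ≡ G₂ i j
      same-rest i j i≢g i≢h = begin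
        G₁ i j           ≡⟨ setRows-other _ G₁ i j i≢g i≢h ⟨
        moveEdge G₁ i j  ≡⟨ same i j ⟩
        moveEdge G₂ i j  ≡⟨ setRows-other _ G₂ i j i≢g i≢h ⟩
        G₂ i j           ∎

module Enumeration (n m : ℕ) where

  open FunctionSpace Bool-setoid using () renaming (pointwise to RowSetoid)
  open FunctionSpace (RowSetoid m) using () renaming (pointwise to GraphSetoid)

  Graphs : Setoid 0ℓ 0ℓ
  Graphs = GraphSetoid n

  open Membership Graphs using (_∈_)

  allBGraphs-complete : ∀ G → G ∈ allBGraphs n m
  allBGraphs-complete G =
    FunctionSpace.allFuns-complete (RowSetoid m) n G
      (λ i → FunctionSpace.allFuns-complete Bool-setoid m (G i) (λ j → bool∈ (G i j)))
    where
    bool∈ : ∀ x → Membership._∈_ Bool-setoid x (true ∷ false ∷ [])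
    bool∈ true  = here refl
    bool∈ false = there (here refl)

  allBGraphs-unique : UniqueSetoid.Unique Graphs (allBGraphs n m)
  allBGraphs-unique =
    FunctionSpace.allFuns-unique (RowSetoid m)
      (FunctionSpace.allFuns-unique Bool-setoid bools-unique m) n
    where
    bools-unique : UniqueSetoid.Unique Bool-setoid (true ∷ false ∷ [])
    bools-unique = ((λ ()) ∷ []) ∷ [] ∷ []

  InB-resp : ∀ {d k} {G G′ : BGraph n m} → (∀ i j → G i j ≡ G′ i j) → InB d k G → InB d k G′
  InB-resp {G = G} {G′} G≈G′ (degX≡d , degY≡k) =
    (λ i → trans (sym (degX-cong i)) (degX≡d i)) , (λ j → trans (sym (degY-cong j)) (degY≡k j))
    where
    degX-cong : ∀ i → degX G i ≡ degX G′ i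
    degX-cong i = trans (degX≡count G i) (trans (count-cong (G≈G′ i)) (sym (degX≡count G′ i)))
    degY-cong : ∀ j → degY G j ≡ degY G′ j
    degY-cong j = trans (degY≡count G j)
      (trans (count-cong (λ i → G≈G′ i j)) (sym (degY≡count G′ j)))

-- B(d,k) is the filtered list of all graphs; moveEdge maps it injectively
-- into the filtered list B(d',k), so the pigeonhole principle applies.
proposition4p3 : (n m : ℕ) (d : Fin n → ℕ) (k : Fin m → ℕ) →
    IsBipartiteDegSeq d k →
    (g h : Fin n) → d h + 2 ≤ d g →
    cardB d k ≤ cardB (shift d g h) k
proposition4p3 n m d k _ g h h+2≤g =
  Pigeonhole.injection-length Graphs Graphs
    (Unique.filter⁺ Graphs (InB? d k) allBGraphs-unique)
    (All.all-filter (InB? d k) (allBGraphs n m))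
    (λ inB₁ inB₂ → moveEdge-injective h<g _ _ inB₁ inB₂)
    (All.map (λ {G} inB → ∈-filter⁺ Graphs (InB? (shift d g h) k) InB-resp
                            (allBGraphs-complete (moveEdge G)) (moveEdge-InB h<g G inB))
             (All.all-filter (InB? d k) (allBGraphs n m)))
  where
  open Enumeration n m
  h<g : d h < d g
  h<g = <-≤-trans (m<m+n (d h) (s≤s z≤n)) h+2≤g
  g≢h : g ≢ h
  g≢h g≡h = <-irrefl (cong d (sym g≡h)) h<g
  open TwoRows {m = m} g≢h
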